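{- Let $(\mathcal{L},\mathcal{G})$ be an irreducible built lattice, $\mathcal{S}=\{G_1,\dots,G_n\}$ an irreducible nested set, and for each $i$ let $\mathcal{S}_i$ be an irreducible nested set of $([\tau_{\mathcal{S}}(G_i),G_i],\mathrm{Ind}_{[\tau_{\mathcal{S}}(G_i),G_i]}(\mathcal{G}))$. Then there is an isomorphism of built lattices $$\bigotimes_i(\mathcal{L}_{\mathcal{S}_i},\mathcal{G}_{\mathcal{S}_i})\xrightarrow{\ \sim\ }(\mathcal{L}_{\mathcal{S}\circ(\mathcal{S}_i)_i},\mathcal{G}_{\mathcal{S}\circ(\mathcal{S}_i)_i}),$$ where $(\mathcal{L}_{\mathcal{S}_i},\mathcal{G}_{\mathcal{S}_i})$ is computed inside the built lattice $([\tau_{\mathcal{S}}(G_i),G_i],\mathrm{Ind}(\mathcal{G}))$.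
   Context: Geometric lattice: finite lattice with bottom $\hat0$, top $\hat1$, all maximal chains between comparable elements of equal length, submodular rank $\rho$, every element a join of atoms. A building set of $\mathcal{L}$ is $\mathcal{G}\subset\mathcal{L}\setminus\{\hat0\}$ such that for every $X$, with $\mathrm{Fact}_{\mathcal{G}}(X)$ the maximal elements of $\mathcal{G}\cap[\hat0,X]$, the join map $\prod_{G\in\mathrm{Fact}_{\mathcal{G}}(X)}[\hat0,G]\to[\hat0,X]$ is a poset isomorphism; $(\mathcal{L},\mathcal{G})$ is a built lattice, irreducible if $\hat1\in\mathcal{G}$. An isomorphism of built lattices $(\mathcal{L},\mathcal{G})\cong(\mathcal{L}',\mathcal{G}')$ is a poset isomorphism carrying $\mathcal{G}$ onto $\mathcal{G}'$. The product is $(\mathcal{L},\mathcal{G})\otimes(\mathcal{L}',\mathcal{G}')=(\mathcal{L}\times\mathcal{L}',\mathcal{G}\times\{\hat0\}\cup\{\hat0\}\times\mathcal{G}')$. For $G<G'$, $\mathrm{Ind}_{[G,G']}(\mathcal{G})=\big(\{G\vee F:F\in\mathcal{G}\}\cap[G,G']\big)\setminus\{G\}$. A subset $\mathcal{S}\subset\mathcal{G}$ is nested if no antichain $\mathcal{A}\subset\mathcal{S}$ with $|\mathcal{A}|\ge2$ has $\bigvee\mathcal{A}\in\mathcal{G}$; irreducible if it contains $\hat1$. For $G\in\mathcal{S}$, $\tau_{\mathcal{S}}(G)=\bigvee\{G'\in\mathcal{S}:G'<G\}$ ($\hat0$ if empty), and $(\mathcal{L}_{\mathcal{S}},\mathcal{G}_{\mathcal{S}}):=\bigotimes_{G\in\mathcal{S}}([\tau_{\mathcal{S}}(G),G],\mathrm{Ind}_{[\tau_{\mathcal{S}}(G),G]}(\mathcal{G}))$.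 For $G<G'$ and $G''\in\mathrm{Ind}_{[G,G']}(\mathcal{G})$, $\mathrm{Comp}_G(G'')$ is the unique maximal $F\in\mathcal{G}$ with $F\vee G=G''$. The composite nested set is $\mathcal{S}\circ(\mathcal{S}_i)_i:=\mathcal{S}\cup\bigcup_i\{\mathrm{Comp}_{\tau_{\mathcal{S}}(G_i)}(K):K\in\mathcal{S}_i\}$, which is an irreducible nested set of $(\mathcal{L},\mathcal{G})$. -}

module Defs where

open import Data.Nat as ℕ using (ℕ; zero; suc; _+_)
open import Data.Bool using (Bool; true; false; _∧_; _∨_; not; T)
open import Data.List using (List; []; _∷_; foldr; filterᵇ; length)
open import Data.Bool.ListAction using (any; all)
open import Data.List.Membership.Propositional using (_∈_)
open import Data.List.Relation.Unary.All using (All)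
open import Data.List.Relation.Unary.Unique.Propositional using (Unique)
open import Data.Product using (Σ; Σ-syntax; ∃; _×_; _,_; proj₁; proj₂)
open import Data.Sum using (_⊎_)
open import Data.Refinement using (Refinement; value)
open import Relation.Nullary using (¬_; ⌊_⌋)
open import Relation.Binary.PropositionalEquality using (_≡_; _≢_; subst; sym)
open import Relation.Binary.Definitions using (Decidable; DecidableEquality)
open import Relation.Binary.Lattice using (IsBoundedLattice)
open import Function using (_⇔_)

-- The lattice axioms, the
-- completeness of the element list and geometricity are imposed
-- separately (IsGeometricLattice) on the ambient lattice L.

record FinLattice : Set₁ where
  infix 4 _≤_ _≤?_ _≟_
  infixr 6 _⊔_
  infixr 7 _⊓_
  field
    Carrier : Set
    _≟_     : DecidableEquality Carrier
    _≤_     : Carrier → Carrier → Set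
    _≤?_    : Decidable _≤_
    _⊔_     : Carrier → Carrier → Carrier
    _⊓_     : Carrier → Carrier → Carrier
    ⊥ ⊤     : Carrier
    elems   : List Carrier

  _≤ᵇ_ : Carrier → Carrier → Bool
  x ≤ᵇ y = ⌊ x ≤? y ⌋

  _==ᵇ_ : Carrier → Carrier → Bool
  x ==ᵇ y = ⌊ x ≟ y ⌋

  _<ᵇ_ : Carrier → Carrier → Bool
  x <ᵇ y = (x ≤ᵇ y) ∧ not (x ==ᵇ y)

  _<_ : Carrier → Carrier → Set
  x < y = x ≤ y × x ≢ y

  ⋁ : Carrier → List Carrier → Carrier
  ⋁ e xs = foldr _⊔_ e xs

  _⋖_ : Carrier → Carrier → Set
  x ⋖ y = x < y × (∀ z → x ≤ z → z ≤ y → z ≡ x ⊎ z ≡ y)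

  data Chain : Carrier → Carrier → ℕ → Set where
    done : ∀ {x} → Chain x x 0
    step : ∀ {x y z n} → x ⋖ y → Chain y z n → Chain x z (suc n)

  Atom : Carrier → Set
  Atom a = ⊥ ⋖ a

record IsGeometricLattice (L : FinLattice) : Set where
  open FinLattice L
  field
    isBoundedLattice : IsBoundedLattice _≡_ _≤_ _⊔_ _⊓_ ⊤ ⊥
    complete         : ∀ x → x ∈ elems
    chains-equal     : ∀ {x y m n} → Chain x y m → Chain x y n → m ≡ n
    ρ                : Carrier → ℕ
    ρ-chain          : ∀ x → Chain ⊥ x (ρ x)
    ρ-submodular     : ∀ x y → ρ (x ⊔ y) + ρ (x ⊓ y) ℕ.≤ ρ x + ρ y
    atomistic        : ∀ x → Σ[ as ∈ List Carrier ] (All Atom as × ⋁ ⊥ as ≡ x)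

module _ (L : FinLattice) where
  open FinLattice L

  Subset : Set
  Subset = Carrier → Bool

  Idx : Subset → Set
  Idx S = Σ Carrier (λ x → T (S x))

  Fact : Subset → Carrier → Subset
  Fact G X F = G F ∧ (F ≤ᵇ X)
               ∧ all (λ F' → not (G F' ∧ (F' ≤ᵇ X) ∧ (F <ᵇ F'))) elems

  idxList : (S : Subset) → List Carrier → List (Idx S)
  idxList S [] = []
  idxList S (x ∷ xs) with S x in eq
  ... | true  = (x , subst T (sym eq) _) ∷ idxList S xs
  ... | false = idxList S xs

  -- G is a building set: G ⊆ L ∖ {⊥} and for every X the join map
  -- ∏_{F ∈ Fact(X)} [⊥,F] → [⊥,X] is a poset isomorphism (written out:
  -- it lands in [⊥,X], preserves and reflects order, and is surjective).
  IsBuildingSet : Subset → Set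
  IsBuildingSet G =
    (∀ x → T (G x) → x ≢ ⊥) ×
    (∀ X →
      let I    = Idx (Fact G X)
          Fam  = (i : I) → Refinement Carrier (λ y → ⊥ ≤ y × y ≤ proj₁ i)
          join : Fam → Carrier
          join f = foldr (λ i acc → value (f i) ⊔ acc) ⊥ (idxList (Fact G X) elems)
      in (∀ f → join f ≤ X)
       × (∀ f g → (∀ i → value (f i) ≤ value (g i)) ⇔ (join f ≤ join g))
       × (∀ y → ⊥ ≤ y → y ≤ X → Σ[ f ∈ Fam ] join f ≡ y))

  Ind : Carrier → Carrier → Subset → Subset
  Ind c d G x = any (λ F → G F ∧ ((c ⊔ F) ==ᵇ x)) elems
                ∧ (c ≤ᵇ x) ∧ (x ≤ᵇ d) ∧ not (x ==ᵇ c)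

  -- Nested set of the built lattice ([lo,hi], G) (joins of nonempty
  -- families in the interval agree with those of L)
  IsAntichain : List Carrier → Set
  IsAntichain A = Unique A × (∀ {a b} → a ∈ A → b ∈ A → a ≤ b → a ≡ b)

  IsNested : Carrier → Carrier → Subset → Subset → Set
  IsNested lo hi G S =
    (∀ x → T (S x) → T (G x)) ×
    (∀ (A : List Carrier) → All (λ a → T (S a)) A → IsAntichain A →
        2 ℕ.≤ length A → ¬ T (G (⋁ lo A)))

  IsIrredNested : Carrier → Carrier → Subset → Subset → Set
  IsIrredNested lo hi G S = IsNested lo hi G S × T (S hi)

  τ : Carrier → Subset → Carrier → Carrier
  τ lo S G = ⋁ lo (filterᵇ (λ G' → S G' ∧ (G' <ᵇ G)) elems)

  IsCompᵇ : Subset → Carrier → Carrier → Carrier → Bool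
  IsCompᵇ G c K F = G F ∧ ((F ⊔ c) ==ᵇ K)
                    ∧ all (λ F' → not (G F' ∧ ((F' ⊔ c) ==ᵇ K)) ∨ (F' ≤ᵇ F)) elems

  -- composite nested set S ∘ (S_i)_i (S_i is given for every G_i ∈ S;
  -- values at non-members of S are ignored)
  Composite : Subset → Subset → (Carrier → Subset) → Subset
  Composite G S Si x =
    S x ∨ any (λ Gi → S Gi ∧ any (λ K → Si Gi K ∧ IsCompᵇ G (τ ⊥ S Gi) K x) elems) elems

record BuiltPoset : Set₁ where
  field
    Carrier : Set
    _≤_     : Carrier → Carrier → Set
    G       : Carrier → Set

IsBot : (P : BuiltPoset) → BuiltPoset.Carrier P → Set
IsBot P x = ∀ y → BuiltPoset._≤_ P x y

-- isomorphism of built lattices: an order isomorphism (order embedding,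
-- surjective up to the order-equivalence x ≤ y ≤ x, which is equality
-- in a poset) carrying the building set onto the building set
record BuiltIso (P Q : BuiltPoset) : Set where
  module P = BuiltPoset P
  module Q = BuiltPoset Q
  field
    to         : P.Carrier → Q.Carrier
    order-iff  : ∀ x y → (P._≤_ x y ⇔ Q._≤_ (to x) (to y))
    surjective : ∀ y → Σ[ x ∈ P.Carrier ] (Q._≤_ (to x) y × Q._≤_ y (to x))
    building   : ∀ x → (P.G x ⇔ Q.G (to x))

IntervalBP : (L : FinLattice) → FinLattice.Carrier L → FinLattice.Carrier L
           → Subset L → BuiltPoset
IntervalBP L lo hi G = record
  { Carrier = Refinement Carrier (λ x → lo ≤ x × x ≤ hi)
  ; _≤_     = λ x y → value x ≤ value y
  ; G       = λ x → T (G (value x))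
  }
  where open FinLattice L

⊗ : (I : Set) → (I → BuiltPoset) → BuiltPoset
⊗ I P = record
  { Carrier = (i : I) → BuiltPoset.Carrier (P i)
  ; _≤_     = λ x y → ∀ i → BuiltPoset._≤_ (P i) (x i) (y i)
  ; G       = λ x → Σ[ i ∈ I ] (BuiltPoset.G (P i) (x i)
                               × (∀ j → j ≢ i → IsBot (P j) (x j)))
  }

LS : (L : FinLattice) → FinLattice.Carrier L → Subset L → Subset L → BuiltPoset
LS L lo G S = ⊗ (Idx L S) (λ i →
  IntervalBP L (τ L lo S (proj₁ i)) (proj₁ i)
               (Ind L (τ L lo S (proj₁ i)) (proj₁ i) G))

module Submission where

-- Write τ for τ_S(Gᵢ) and c for Comp_τ(K), where K ∈ Sᵢ.  Since c is a factor of K in the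
-- building-set decomposition and c ∨ τ = K, every other factor of K lies below τ; hence
-- z ↦ z ∧ c maps [τ_{Sᵢ}(K), K] onto [τ(c), c] with inverse y ↦ y ∨ τ, and it carries the
-- twice-induced building set onto the induced one.  The pairs (Gᵢ, K) are in bijection with
-- the composite nested set via K ↦ Comp_τ(K): Comp is unique, and a G-element cannot lie
-- below two incomparable members of the nested set S.  Assembling the coordinate maps gives
-- the isomorphism.

open import Defs
open import Data.Bool using (Bool; true; false; T; not; _∧_; _∨_)
open import Data.Bool.Properties using (T-∧; T-∨; T-irrelevant)
open import Data.Bool.ListAction using (any; all)
open import Data.Empty using (⊥-elim) renaming (⊥ to Empty)
open import Data.List using (List; []; _∷_; foldr; filterᵇ; length)
open import Data.List.Membership.Propositional using (_∈_; find; lose)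
import Data.List.Membership.DecPropositional as DecMembership
open import Data.List.Membership.Propositional.Properties using (∈-filter⁺; ∈-filter⁻)
open import Data.List.Relation.Unary.Any using (here; there)
open import Data.List.Relation.Unary.Any.Properties using (any⁺; any⁻)
open import Data.List.Relation.Unary.All using ([]; _∷_; tabulate; lookup)
open import Data.List.Relation.Unary.All.Properties using (all⁺; all⁻)
open import Data.List.Relation.Unary.All.Properties.Core using (¬All⇒Any¬)
open import Data.List.Relation.Unary.AllPairs using ([]; _∷_)
import Data.Nat as ℕ
import Data.Nat.Properties as ℕ
open import Data.Product using (Σ-syntax; _×_; _,_; proj₁; proj₂)
open import Data.Sum using (_⊎_; inj₁; inj₂; [_,_]′)
open import Data.Unit using (tt)
open import Data.Refinement using (Refinement; value; _,_)
open import Data.Irrelevant using ([_])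
open import Function using (Equivalence; _∘_; _⇔_; mk⇔)
open import Relation.Binary.Definitions using (DecidableEquality)
open import Relation.Binary.Lattice using (BoundedLattice)
import Relation.Binary.Reasoning.PartialOrder
open import Relation.Binary.PropositionalEquality using (_≡_; _≢_; refl; sym; trans; cong; subst)
open import Relation.Nullary using (¬_; yes; no)
open import Relation.Nullary.Decidable using (toWitness; fromWitness; recompute; T?)

T-∧⁺ : ∀ {a b} → T a → T b → T (a ∧ b)
T-∧⁺ p q = Equivalence.from T-∧ (p , q)

T-∧⁻ : ∀ a {b} → T (a ∧ b) → T a × T b
T-∧⁻ a = Equivalence.to (T-∧ {a})

T-not⁺ : ∀ {b} → ¬ T b → T (not b)
T-not⁺ {true}  ¬b = ¬b tt
T-not⁺ {false} _  = tt

T-not⁻ : ∀ {b} → T (not b) → ¬ T b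
T-not⁻ {false} _ ()

¬T-not⇒T : ∀ {b} → ¬ T (not b) → T b
¬T-not⇒T {true}  _   = tt
¬T-not⇒T {false} ¬nb = ¬nb tt

module _ {A : Set} (p q : A → Bool) (p⇒q : ∀ z → T (p z) → T (q z)) where

  length-filterᵇ-mono : ∀ xs → length (filterᵇ p xs) ℕ.≤ length (filterᵇ q xs)
  length-filterᵇ-mono [] = ℕ.z≤n
  length-filterᵇ-mono (y ∷ xs) with p y in py | q y in qy
  ... | true  | true  = ℕ.s≤s (length-filterᵇ-mono xs)
  ... | true  | false = ⊥-elim (subst T qy (p⇒q y (subst T (sym py) tt)))
  ... | false | true  = ℕ.m≤n⇒m≤1+n (length-filterᵇ-mono xs)
  ... | false | false = length-filterᵇ-mono xs

  length-filterᵇ-< : ∀ xs {a} → a ∈ xs → T (q a) → ¬ T (p a)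
                   → length (filterᵇ p xs) ℕ.< length (filterᵇ q xs)
  length-filterᵇ-< (y ∷ xs) (here refl) qa ¬pa with p y | q y
  ... | true  | _     = ⊥-elim (¬pa tt)
  ... | false | true  = ℕ.s≤s (length-filterᵇ-mono xs)
  ... | false | false = ⊥-elim qa
  length-filterᵇ-< (y ∷ xs) (there a∈xs) qa ¬pa with p y in py | q y in qy
  ... | true  | true  = ℕ.s≤s (length-filterᵇ-< xs a∈xs qa ¬pa)
  ... | true  | false = ⊥-elim (subst T qy (p⇒q y (subst T (sym py) tt)))
  ... | false | true  = ℕ.m≤n⇒m≤1+n (length-filterᵇ-< xs a∈xs qa ¬pa)
  ... | false | false = length-filterᵇ-< xs a∈xs qa ¬pa

module LatticeProperties (L : FinLattice) (geo : IsGeometricLattice L) where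
  open FinLattice L public
  open IsGeometricLattice geo public using (complete)

  boundedLattice : BoundedLattice _ _ _
  boundedLattice = record { isBoundedLattice = IsGeometricLattice.isBoundedLattice geo }

  open BoundedLattice boundedLattice public
    using (x≤x∨y; y≤x∨y; ∨-least; x∧y≤x; x∧y≤y; ∧-greatest)
    renaming (refl to ≤-refl; trans to ≤-trans; antisym to ≤-antisym;
              reflexive to ≤-reflexive; minimum to ⊥-minimum)
  open BoundedLattice boundedLattice using (joinSemilattice; meetSemilattice; poset)
  module ≤-Reasoning = Relation.Binary.Reasoning.PartialOrder poset
  open import Relation.Binary.Lattice.Properties.JoinSemilattice joinSemilattice public
    using (∨-monotonic)
  open import Relation.Binary.Lattice.Properties.MeetSemilattice meetSemilattice public
    using (∧-monotonic)

  x≤y⇒x≤y∨z : ∀ {x y z} → x ≤ y → x ≤ y ⊔ z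
  x≤y⇒x≤y∨z x≤y = ≤-trans x≤y (x≤x∨y _ _)

  x≤z⇒x≤y∨z : ∀ {x y z} → x ≤ z → x ≤ y ⊔ z
  x≤z⇒x≤y∨z x≤z = ≤-trans x≤z (y≤x∨y _ _)

  x≤⊥⇒x≡⊥ : ∀ {x} → x ≤ ⊥ → x ≡ ⊥
  x≤⊥⇒x≡⊥ x≤⊥ = ≤-antisym x≤⊥ (⊥-minimum _)

  Interval : Carrier → Carrier → Set
  Interval a b = Refinement Carrier (λ y → a ≤ y × y ≤ b)

  inInterval : ∀ {a b} x → a ≤ x → x ≤ b → Interval a b
  inInterval x a≤x x≤b = x , [ (a≤x , x≤b) ]

  interval-lower : ∀ {a b} (x : Interval a b) → a ≤ value x
  interval-lower (_ , [ p ]) = recompute (_ ≤? _) (proj₁ p)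

  interval-upper : ∀ {a b} (x : Interval a b) → value x ≤ b
  interval-upper (_ , [ p ]) = recompute (_ ≤? _) (proj₂ p)

  ≤ᵇ⇒≤ : ∀ {x y} → T (x ≤ᵇ y) → x ≤ y
  ≤ᵇ⇒≤ = toWitness

  ≤⇒≤ᵇ : ∀ {x y} → x ≤ y → T (x ≤ᵇ y)
  ≤⇒≤ᵇ = fromWitness

  ==ᵇ⇒≡ : ∀ {x y} → T (x ==ᵇ y) → x ≡ y
  ==ᵇ⇒≡ = toWitness

  ≡⇒==ᵇ : ∀ {x y} → x ≡ y → T (x ==ᵇ y)
  ≡⇒==ᵇ = fromWitness

  <ᵇ⇒< : ∀ {x y} → T (x <ᵇ y) → x < y
  <ᵇ⇒< {x} {y} x<ᵇy =
    let x≤ᵇy , x≠ᵇy = T-∧⁻ (x ≤ᵇ y) x<ᵇy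
    in ≤ᵇ⇒≤ x≤ᵇy , T-not⁻ x≠ᵇy ∘ ≡⇒==ᵇ

  <⇒<ᵇ : ∀ {x y} → x < y → T (x <ᵇ y)
  <⇒<ᵇ (x≤y , x≢y) = T-∧⁺ (≤⇒≤ᵇ x≤y) (T-not⁺ (x≢y ∘ ==ᵇ⇒≡))

  module _ {I : Set} (f : I → Carrier) (e : Carrier) where

    foldr-⊔-base : ∀ is → e ≤ foldr (λ i acc → f i ⊔ acc) e is
    foldr-⊔-base []       = ≤-refl
    foldr-⊔-base (_ ∷ is) = x≤z⇒x≤y∨z (foldr-⊔-base is)

    foldr-⊔-upper : ∀ is {i} → i ∈ is → f i ≤ foldr (λ i acc → f i ⊔ acc) e is
    foldr-⊔-upper (_ ∷ is) (here refl)  = x≤x∨y _ _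
    foldr-⊔-upper (_ ∷ is) (there i∈is) = x≤z⇒x≤y∨z (foldr-⊔-upper is i∈is)

    foldr-⊔-least : ∀ is {u} → e ≤ u → (∀ {i} → i ∈ is → f i ≤ u)
                  → foldr (λ i acc → f i ⊔ acc) e is ≤ u
    foldr-⊔-least []       e≤u _     = e≤u
    foldr-⊔-least (_ ∷ is) e≤u bound =
      ∨-least (bound (here refl)) (foldr-⊔-least is e≤u (bound ∘ there))

  strictlyBelow : Subset L → Carrier → List Carrier
  strictlyBelow S g = filterᵇ (λ m → S m ∧ (m <ᵇ g)) elems

  τ-lower : ∀ lo S g → lo ≤ τ L lo S g
  τ-lower lo S g = foldr-⊔-base (λ x → x) lo (strictlyBelow S g)

  τ-upper : ∀ lo S g {m} → T (S m) → m < g → m ≤ τ L lo S g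
  τ-upper lo S g {m} m∈S m<g =
    foldr-⊔-upper (λ x → x) lo (strictlyBelow S g)
      (∈-filter⁺ (T? ∘ (λ m → S m ∧ (m <ᵇ g))) (complete m) (T-∧⁺ m∈S (<⇒<ᵇ m<g)))

  τ-least : ∀ lo S g {u} → lo ≤ u → (∀ m → T (S m) → m < g → m ≤ u) → τ L lo S g ≤ u
  τ-least lo S g lo≤u bound =
    foldr-⊔-least (λ x → x) lo (strictlyBelow S g) lo≤u λ {m} m∈ →
      let m∈S , m<ᵇg = T-∧⁻ (S m) (proj₂ (∈-filter⁻ (T? ∘ (λ m → S m ∧ (m <ᵇ g))) {xs = elems} m∈))
      in bound m m∈S (<ᵇ⇒< m<ᵇg)

  τ≤ : ∀ lo S g → lo ≤ g → τ L lo S g ≤ g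
  τ≤ lo S g lo≤g = τ-least lo S g lo≤g (λ _ _ → proj₁)

  Ind⁻ : ∀ c d G x → T (Ind L c d G x)
       → (Σ[ F ∈ Carrier ] T (G F) × c ⊔ F ≡ x) × c ≤ x × x ≤ d × x ≢ c
  Ind⁻ c d G x x∈Ind =
    let generated , rest   = T-∧⁻ (any (λ F → G F ∧ ((c ⊔ F) ==ᵇ x)) elems) x∈Ind
        F , _ , F∈G∧c∨F=x = find (any⁻ _ elems generated)
        F∈G , c∨F=x       = T-∧⁻ (G F) F∈G∧c∨F=x
        c≤x , rest′       = T-∧⁻ (c ≤ᵇ x) rest
        x≤d , x≠c         = T-∧⁻ (x ≤ᵇ d) rest′
    in (F , F∈G , ==ᵇ⇒≡ c∨F=x) , ≤ᵇ⇒≤ c≤x , ≤ᵇ⇒≤ x≤d , T-not⁻ x≠c ∘ ≡⇒==ᵇ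

  Ind⁺ : ∀ c d G x F → T (G F) → c ⊔ F ≡ x → c ≤ x → x ≤ d → x ≢ c → T (Ind L c d G x)
  Ind⁺ c d G x F F∈G c∨F≡x c≤x x≤d x≢c =
    T-∧⁺ (any⁺ _ (lose (complete F) (T-∧⁺ F∈G (≡⇒==ᵇ c∨F≡x))))
         (T-∧⁺ (≤⇒≤ᵇ c≤x) (T-∧⁺ (≤⇒≤ᵇ x≤d) (T-not⁺ (x≢c ∘ ==ᵇ⇒≡))))

  Idx-≡ : ∀ {S : Subset L} (a b : Idx L S) → proj₁ a ≡ proj₁ b → a ≡ b
  Idx-≡ (x , p) (.x , q) refl = cong (x ,_) (T-irrelevant p q)

  Idx-≟ : ∀ {S : Subset L} → DecidableEquality (Idx L S)
  Idx-≟ a b with proj₁ a ≟ proj₁ b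
  ... | yes a≡b = yes (Idx-≡ a b a≡b)
  ... | no  a≢b = no (a≢b ∘ cong proj₁)

  strictlyAbove : Carrier → List Carrier
  strictlyAbove x = filterᵇ (x <ᵇ_) elems

  strictlyAbove-shrinks : ∀ {x y} → x < y → length (strictlyAbove y) ℕ.< length (strictlyAbove x)
  strictlyAbove-shrinks {x} {y} (x≤y , x≢y) =
    length-filterᵇ-< (y <ᵇ_) (x <ᵇ_) above-y⇒above-x elems (complete y)
      (<⇒<ᵇ (x≤y , x≢y)) (λ y<ᵇy → proj₂ (<ᵇ⇒< y<ᵇy) refl)
    where
      above-y⇒above-x : ∀ z → T (y <ᵇ z) → T (x <ᵇ z)
      above-y⇒above-x z y<ᵇz =
        let y≤z , y≢z = <ᵇ⇒< y<ᵇz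
        in <⇒<ᵇ (≤-trans x≤y y≤z , λ x≡z → y≢z (≤-antisym y≤z (subst (_≤ y) x≡z x≤y)))

module BuildingSetProperties (L : FinLattice) (geo : IsGeometricLattice L)
                             (G : Subset L) (bs : IsBuildingSet L G) where
  open LatticeProperties L geo public
  private module Idx-DecMembership {S : Subset L} = DecMembership (Idx-≟ {S})

  G∌⊥ : ∀ x → T (G x) → x ≢ ⊥
  G∌⊥ = proj₁ bs

  module Factors (X : Carrier) where

    Factor : Set
    Factor = Idx L (Fact L G X)

    Family : Set
    Family = (A : Factor) → Interval ⊥ (proj₁ A)

    factors : List Factor
    factors = idxList L (Fact L G X) elems

    join : Family → Carrier
    join f = foldr (λ A acc → value (f A) ⊔ acc) ⊥ factors

    join≤X : ∀ f → join f ≤ X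
    join≤X = proj₁ (proj₂ bs X)

    join-mono : ∀ f g → (∀ A → value (f A) ≤ value (g A)) → join f ≤ join g
    join-mono f g = Equivalence.to (proj₁ (proj₂ (proj₂ bs X)) f g)

    join-reflects : ∀ f g → join f ≤ join g → ∀ A → value (f A) ≤ value (g A)
    join-reflects f g = Equivalence.from (proj₁ (proj₂ (proj₂ bs X)) f g)

    join-surjective : ∀ y → y ≤ X → Σ[ f ∈ Family ] join f ≡ y
    join-surjective y = proj₂ (proj₂ (proj₂ bs X)) y (⊥-minimum y)

    factor∈G : (A : Factor) → T (G (proj₁ A))
    factor∈G (F , F∈Fact) = proj₁ (T-∧⁻ (G F) F∈Fact)

    factor≤X : (A : Factor) → proj₁ A ≤ X
    factor≤X (F , F∈Fact) = ≤ᵇ⇒≤ (proj₁ (T-∧⁻ (F ≤ᵇ X) (proj₂ (T-∧⁻ (G F) F∈Fact))))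

    family : (v : Factor → Carrier) → (∀ A → v A ≤ proj₁ A) → Family
    family v v≤ A = inInterval (v A) (⊥-minimum _) (v≤ A)

    factorFamily : Family
    factorFamily = family proj₁ (λ _ → ≤-refl)

    single : Factor → Carrier → Factor → Carrier
    single A w B with proj₁ B ≟ proj₁ A
    ... | yes _ = w
    ... | no  _ = ⊥

    single-at : ∀ A w → single A w A ≡ w
    single-at A w with proj₁ A ≟ proj₁ A
    ... | yes _   = refl
    ... | no  A≢A = ⊥-elim (A≢A refl)

    single-off : ∀ A w B → proj₁ B ≢ proj₁ A → single A w B ≡ ⊥
    single-off A w B B≢A with proj₁ B ≟ proj₁ A
    ... | yes B≡A = ⊥-elim (B≢A B≡A)
    ... | no  _   = refl

    single≤factor : ∀ A w → w ≤ proj₁ A → ∀ B → single A w B ≤ proj₁ B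
    single≤factor A w w≤A B with proj₁ B ≟ proj₁ A
    ... | yes B≡A = ≤-trans w≤A (≤-reflexive (sym B≡A))
    ... | no  _   = ⊥-minimum _

    single≤ : ∀ A w B → single A w B ≤ w
    single≤ A w B with proj₁ B ≟ proj₁ A
    ... | yes _ = ≤-refl
    ... | no  _ = ⊥-minimum _

    singleFamily : (A : Factor) (w : Carrier) → w ≤ proj₁ A → Family
    singleFamily A w w≤A = family (single A w) (single≤factor A w w≤A)

    -- A factor missing from the list would be forced to ⊥ by order reflection.
    ≤join : ∀ (f : Family) A → value (f A) ≤ join f
    ≤join f A with Idx-DecMembership._∈?_ A factors
    ... | yes A∈ = foldr-⊔-upper (value ∘ f) ⊥ factors A∈
    ... | no  A∉ = ⊥-elim (G∌⊥ (proj₁ A) (factor∈G A) (x≤⊥⇒x≡⊥ A≤⊥))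
      where
        s : Family
        s = singleFamily A (proj₁ A) ≤-refl
        bottom : Family
        bottom = family (λ _ → ⊥) (λ _ → ⊥-minimum _)
        join-s≤⊥ : join s ≤ join bottom
        join-s≤⊥ = ≤-trans
          (foldr-⊔-least (value ∘ s) ⊥ factors ≤-refl
            (λ {B} B∈ → ≤-reflexive (single-off A _ B (λ B≡A → A∉ (subst (_∈ _) (Idx-≡ B A B≡A) B∈)))))
          (⊥-minimum _)
        A≤⊥ : proj₁ A ≤ ⊥
        A≤⊥ = ≤-trans (≤-reflexive (sym (single-at A _))) (join-reflects s bottom join-s≤⊥ A)

    join-least : ∀ f {u} → (∀ A → value (f A) ≤ u) → join f ≤ u
    join-least f bound = foldr-⊔-least (value ∘ f) ⊥ factors (⊥-minimum _) (λ {A} _ → bound A)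

    join-single≤ : ∀ A w w≤A → join (singleFamily A w w≤A) ≤ w
    join-single≤ A w w≤A = join-least (singleFamily A w w≤A) (single≤ A w)

    ≤join-single : ∀ A w w≤A → w ≤ join (singleFamily A w w≤A)
    ≤join-single A w w≤A = ≤-trans (≤-reflexive (sym (single-at A w))) (≤join (singleFamily A w w≤A) A)

    single∨ : (A : Factor) (w : Carrier) → w ≤ proj₁ A → Family → Family
    single∨ A w w≤A f = family (λ B → single A w B ⊔ value (f B))
                               (λ B → ∨-least (single≤factor A w w≤A B) (interval-upper (f B)))

    ≤join-single∨ : ∀ A w w≤A f → w ⊔ join f ≤ join (single∨ A w w≤A f)
    ≤join-single∨ A w w≤A f =
      ∨-least (≤-trans (≤join-single A w w≤A) (join-mono (singleFamily A w w≤A) s (λ _ → x≤x∨y _ _)))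
              (join-mono f s (λ _ → y≤x∨y _ _))
      where
        s : Family
        s = single∨ A w w≤A f

    factors-disjoint : ∀ (A B : Factor) → proj₁ A ≢ proj₁ B
                     → ∀ {w} → w ≤ proj₁ A → w ≤ proj₁ B → w ≡ ⊥
    factors-disjoint A B A≢B {w} w≤A w≤B =
      let sA≤sB = join-reflects (singleFamily A w w≤A) (singleFamily B w w≤B)
                    (≤-trans (join-single≤ A w w≤A) (≤join-single B w w≤B)) A
      in x≤⊥⇒x≡⊥ (≤-trans (≤-reflexive (sym (single-at A w)))
                          (≤-trans sA≤sB (≤-reflexive (single-off B w A A≢B))))

    other-factors-below : ∀ (A A′ : Factor) → proj₁ A′ ≢ proj₁ A
                        → ∀ {E t} → E ≤ proj₁ A′ → t ≤ X → X ≤ E ⊔ t → proj₁ A ≤ t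
    other-factors-below A A′ A′≢A {E} {t} E≤A′ t≤X X≤E∨t =
      let f , join-f≡t = join-surjective t t≤X
          X≤join = ≤-trans X≤E∨t (≤-trans (∨-monotonic ≤-refl (≤-reflexive (sym join-f≡t)))
                                         (≤join-single∨ A′ E E≤A′ f))
          A≤ = join-reflects factorFamily (single∨ A′ E E≤A′ f) (≤-trans (join≤X factorFamily) X≤join) A
      in ≤-trans A≤ (∨-least (≤-trans (≤-reflexive (single-off A′ E A (A′≢A ∘ sym))) (⊥-minimum _))
                             (≤-trans (≤join f A) (≤-reflexive join-f≡t)))

    [y∨t]∧factor≤y : ∀ (C : Factor) {t y} → t ≤ X → y ≤ proj₁ C → t ⊓ proj₁ C ≤ y
                   → (y ⊔ t) ⊓ proj₁ C ≤ y
    [y∨t]∧factor≤y C {t} {y} t≤X y≤C t∧C≤y =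
      let w = (y ⊔ t) ⊓ proj₁ C
          f , join-f≡t = join-surjective t t≤X
          w≤join = ≤-trans (join-single≤ C w (x∧y≤y _ _))
                     (≤-trans (x∧y≤x _ _) (≤-trans (∨-monotonic ≤-refl (≤-reflexive (sym join-f≡t)))
                                                  (≤join-single∨ C y y≤C f)))
          w≤y∨fC = ≤-trans (≤-reflexive (sym (single-at C w)))
                     (≤-trans (join-reflects (singleFamily C w (x∧y≤y _ _)) (single∨ C y y≤C f) w≤join C)
                              (∨-monotonic (≤-reflexive (single-at C y)) ≤-refl))
          fC≤y = ≤-trans (∧-greatest (≤-trans (≤join f C) (≤-reflexive join-f≡t)) (interval-upper (f C))) t∧C≤y
      in ≤-trans w≤y∨fC (∨-least ≤-refl fC≤y)

    ≤[z∧factor]∨t : ∀ (C : Factor) {t z} → (∀ (B : Factor) → proj₁ B ≢ proj₁ C → proj₁ B ≤ t)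
                  → z ≤ X → z ≤ (z ⊓ proj₁ C) ⊔ t
    ≤[z∧factor]∨t C {t} {z} others≤t z≤X =
      let f , join-f≡z = join-surjective z z≤X
      in ≤-trans (≤-reflexive (sym join-f≡z)) (join-least f (component≤ f join-f≡z))
      where
        component≤ : ∀ f → join f ≡ z → ∀ B → value (f B) ≤ (z ⊓ proj₁ C) ⊔ t
        component≤ f join-f≡z B with proj₁ B ≟ proj₁ C
        ... | yes B≡C = x≤y⇒x≤y∨z (∧-greatest (≤-trans (≤join f B) (≤-reflexive join-f≡z))
                                              (≤-trans (interval-upper (f B)) (≤-reflexive B≡C)))
        ... | no  B≢C = x≤z⇒x≤y∨z (≤-trans (interval-upper (f B)) (others≤t B B≢C))

    -- The fuel n bounds the number of elements strictly above E, so the climb terminates.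
    factor-above′ : ∀ n E → T (G E) → E ≤ X → length (strictlyAbove E) ℕ.< n → Σ[ A ∈ Factor ] E ≤ proj₁ A
    factor-above′ (ℕ.suc n) E E∈G E≤X bound
      with T? (all (λ F → not (G F ∧ (F ≤ᵇ X) ∧ (E <ᵇ F))) elems)
    ... | yes maximal = (E , T-∧⁺ E∈G (T-∧⁺ (≤⇒≤ᵇ E≤X) maximal)) , ≤-refl
    ... | no ¬maximal =
      let F , _ , bigger  = find (¬All⇒Any¬ (T? ∘ _) elems (¬maximal ∘ all⁻ _))
          F∈G , rest      = T-∧⁻ (G F) (¬T-not⇒T bigger)
          F≤X , E<ᵇF      = T-∧⁻ (F ≤ᵇ X) rest
          E<F             = <ᵇ⇒< E<ᵇF
          A , F≤A         = factor-above′ n F F∈G (≤ᵇ⇒≤ F≤X)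
                              (ℕ.<-≤-trans (strictlyAbove-shrinks E<F) (ℕ.≤-pred bound))
      in A , ≤-trans (proj₁ E<F) F≤A

    factor-above : ∀ E → T (G E) → E ≤ X → Σ[ A ∈ Factor ] E ≤ proj₁ A
    factor-above E E∈G E≤X = factor-above′ _ E E∈G E≤X (ℕ.n<1+n _)

  open Factors public using (Factor; factor∈G; factor≤X; factor-above; factors-disjoint; other-factors-below)

  IsComp : Carrier → Carrier → Carrier → Set
  IsComp t K F = T (G F) × F ⊔ t ≡ K × (∀ F′ → T (G F′) → F′ ⊔ t ≡ K → F′ ≤ F)

  IsCompᵇ⇒IsComp : ∀ t K F → T (IsCompᵇ L G t K F) → IsComp t K F
  IsCompᵇ⇒IsComp t K F F∈Comp =
    let F∈G , rest        = T-∧⁻ (G F) F∈Comp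
        F∨t≡K , maximal   = T-∧⁻ ((F ⊔ t) ==ᵇ K) rest
    in F∈G , ==ᵇ⇒≡ F∨t≡K , λ F′ F′∈G F′∨t≡K →
         [ (λ ¬generates → ⊥-elim (T-not⁻ ¬generates (T-∧⁺ F′∈G (≡⇒==ᵇ F′∨t≡K)))) , ≤ᵇ⇒≤ ]′
           (Equivalence.to T-∨ (lookup (all⁺ _ elems maximal) (complete F′)))

  IsComp⇒IsCompᵇ : ∀ t K F → IsComp t K F → T (IsCompᵇ L G t K F)
  IsComp⇒IsCompᵇ t K F (F∈G , F∨t≡K , maximal) =
    T-∧⁺ F∈G (T-∧⁺ (≡⇒==ᵇ F∨t≡K) (all⁻ _ {xs = elems} (tabulate (λ {F′} _ → below F′))))
    where
      below : ∀ F′ → T (not (G F′ ∧ ((F′ ⊔ t) ==ᵇ K)) ∨ (F′ ≤ᵇ F))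
      below F′ with G F′ ∧ ((F′ ⊔ t) ==ᵇ K) in generates
      ... | false = tt
      ... | true  = let F′∈G , F′∨t≡K = T-∧⁻ (G F′) (subst T (sym generates) tt)
                    in ≤⇒≤ᵇ (maximal F′ F′∈G (==ᵇ⇒≡ F′∨t≡K))

  Comp-unique : ∀ {t K F F′} → IsComp t K F → IsComp t K F′ → F ≡ F′
  Comp-unique (F∈G , F∨t≡K , F-max) (F′∈G , F′∨t≡K , F′-max) =
    ≤-antisym (F′-max _ F∈G F∨t≡K) (F-max _ F′∈G F′∨t≡K)

  -- Any other factor of K lies below t, so it cannot help generate K ≠ t.
  generating-factor-is-Comp : ∀ {t K} (A : Factor K) → t ≤ K → K ≢ t → proj₁ A ⊔ t ≡ K
                            → IsComp t K (proj₁ A)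
  generating-factor-is-Comp {t} {K} A t≤K K≢t A∨t≡K = factor∈G K A , A∨t≡K , maximal
    where
      maximal : ∀ F′ → T (G F′) → F′ ⊔ t ≡ K → F′ ≤ proj₁ A
      maximal F′ F′∈G F′∨t≡K with factor-above K F′ F′∈G (≤-trans (x≤x∨y _ _) (≤-reflexive F′∨t≡K))
      ... | A′ , F′≤A′ with proj₁ A′ ≟ proj₁ A
      ...   | yes A′≡A = ≤-trans F′≤A′ (≤-reflexive A′≡A)
      ...   | no  A′≢A = ⊥-elim (K≢t (≤-antisym K≤t t≤K))
        where
          K≤t : K ≤ t
          K≤t = ≤-trans (≤-reflexive (sym A∨t≡K))
                  (∨-least (other-factors-below K A A′ A′≢A F′≤A′ t≤K (≤-reflexive (sym F′∨t≡K))) ≤-refl)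

  Ind⇒Comp : ∀ t hi K → T (Ind L t hi G K) → Σ[ F ∈ Carrier ] IsComp t K F
  Ind⇒Comp t hi K K∈Ind =
    let (F , F∈G , t∨F≡K) , t≤K , _ , K≢t = Ind⁻ t hi G K K∈Ind
        A , F≤A = factor-above K F F∈G (≤-trans (y≤x∨y _ _) (≤-reflexive t∨F≡K))
        A∨t≡K   = ≤-antisym (∨-least (factor≤X K A) t≤K)
                    (≤-trans (≤-reflexive (sym t∨F≡K)) (∨-least (y≤x∨y _ _) (x≤y⇒x≤y∨z F≤A)))
    in proj₁ A , generating-factor-is-Comp A t≤K K≢t A∨t≡K

module Composition (L : FinLattice) (geo : IsGeometricLattice L) (G : Subset L) (bs : IsBuildingSet L G)
  (S : Subset L) (S-nested : IsIrredNested L (FinLattice.⊥ L) (FinLattice.⊤ L) G S)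
  (Si : FinLattice.Carrier L → Subset L)
  (Si-nested : ∀ g → T (S g) → IsIrredNested L (τ L (FinLattice.⊥ L) S g) g
                                  (Ind L (τ L (FinLattice.⊥ L) S g) g G) (Si g)) where
  open BuildingSetProperties L geo G bs public

  τS : Carrier → Carrier
  τS = τ L ⊥ S

  S∘Si : Subset L
  S∘Si = Composite L G S Si

  S⊆G : ∀ g → T (S g) → T (G g)
  S⊆G = proj₁ (proj₁ S-nested)

  Si⊆Ind : ∀ g → T (S g) → ∀ K → T (Si g K) → T (Ind L (τS g) g G K)
  Si⊆Ind g g∈S = proj₁ (proj₁ (Si-nested g g∈S))

  Comp-self : ∀ g → T (S g) → IsComp (τS g) g g
  Comp-self g g∈S = S⊆G g g∈S
                  , ≤-antisym (∨-least ≤-refl (τ≤ ⊥ S g (⊥-minimum g))) (x≤x∨y _ _)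
                  , λ _ _ F′∨τ≡g → ≤-trans (x≤x∨y _ _) (≤-reflexive F′∨τ≡g)

  S⊆S∘Si : ∀ g → T (S g) → T (S∘Si g)
  S⊆S∘Si g g∈S = Equivalence.from (T-∨ {S g}) (inj₁ g∈S)

  Comp∈S∘Si : ∀ g → T (S g) → ∀ K → T (Si g K) → ∀ F → IsComp (τS g) K F → T (S∘Si F)
  Comp∈S∘Si g g∈S K K∈Si F F-comp = Equivalence.from (T-∨ {S F}) (inj₂
    (any⁺ _ (lose (complete g) (T-∧⁺ g∈S
      (any⁺ _ (lose (complete K) (T-∧⁺ K∈Si (IsComp⇒IsCompᵇ (τS g) K F F-comp))))))))

  CompWitness : Carrier → Set
  CompWitness F = Σ[ g ∈ Carrier ] T (S g) × Σ[ K ∈ Carrier ] T (Si g K) × IsComp (τS g) K F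

  -- Members of S are witnessed by themselves: G = Comp_{τ(G)}(G) with G ∈ S_G.
  S∘Si-witness : ∀ F → T (S∘Si F) → CompWitness F
  S∘Si-witness F F∈S∘Si with Equivalence.to (T-∨ {S F}) F∈S∘Si
  ... | inj₁ F∈S   = F , F∈S , F , proj₂ (Si-nested F F∈S) , Comp-self F F∈S
  ... | inj₂ F∈Comp =
    let g , _ , g∈S∧K∃ = find (any⁻ _ elems F∈Comp)
        g∈S , K∃       = T-∧⁻ (S g) g∈S∧K∃
        K , _ , K∈Si∧F = find (any⁻ _ elems K∃)
        K∈Si , F-comp  = T-∧⁻ (Si g K) K∈Si∧F
    in g , g∈S , K , K∈Si , IsCompᵇ⇒IsComp (τS g) K F F-comp

  -- Incomparable members of S are distinct factors of their join, because S is nested.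
  S-incomparable-disjoint : ∀ {g g′} → T (S g) → T (S g′) → ¬ g ≤ g′ → ¬ g′ ≤ g
                          → ∀ {E} → T (G E) → E ≤ g → ¬ E ≤ g′
  S-incomparable-disjoint {g} {g′} g∈S g′∈S g≰g′ g′≰g {E} E∈G E≤g E≤g′ =
    separate (factor-above X g (S⊆G g g∈S) (x≤x∨y _ _))
             (factor-above X g′ (S⊆G g′ g′∈S) (x≤z⇒x≤y∨z (x≤x∨y _ _)))
    where
      X : Carrier
      X = ⋁ ⊥ (g ∷ g′ ∷ [])

      antichain : IsAntichain L (g ∷ g′ ∷ [])
      antichain = ((λ g≡g′ → g≰g′ (≤-reflexive g≡g′)) ∷ []) ∷ [] ∷ [] , comparable⇒≡
        where
          comparable⇒≡ : ∀ {a b} → a ∈ g ∷ g′ ∷ [] → b ∈ g ∷ g′ ∷ [] → a ≤ b → a ≡ b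
          comparable⇒≡ (here refl)         (here refl)         _   = refl
          comparable⇒≡ (here refl)         (there (here refl)) g≤g′ = ⊥-elim (g≰g′ g≤g′)
          comparable⇒≡ (there (here refl)) (here refl)         g′≤g = ⊥-elim (g′≰g g′≤g)
          comparable⇒≡ (there (here refl)) (there (here refl)) _   = refl

      separate : Σ[ A ∈ Factor X ] g ≤ proj₁ A → Σ[ B ∈ Factor X ] g′ ≤ proj₁ B → Empty
      separate (A , g≤A) (B , g′≤B) with proj₁ A ≟ proj₁ B
      ... | no  A≢B = G∌⊥ E E∈G (factors-disjoint X A B A≢B (≤-trans E≤g g≤A) (≤-trans E≤g′ g′≤B))
      ... | yes A≡B = proj₂ (proj₁ S-nested) (g ∷ g′ ∷ []) (g∈S ∷ g′∈S ∷ []) antichain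
                        (ℕ.s≤s (ℕ.s≤s ℕ.z≤n)) (subst (T ∘ G) (sym X≡A) (factor∈G X A))
        where
          X≡A : X ≡ proj₁ A
          X≡A = ≤-antisym (∨-least g≤A (∨-least (≤-trans g′≤B (≤-reflexive (sym A≡B))) (⊥-minimum _)))
                          (factor≤X X A)

  module Component {g} (g∈S : T (S g)) {K} (K∈Si : T (Si g K)) {c} (c-comp : IsComp (τS g) K c) where

    c∨τ≡K : c ⊔ τS g ≡ K
    c∨τ≡K = proj₁ (proj₂ c-comp)

    τ≤K : τS g ≤ K
    τ≤K = proj₁ (proj₂ (Ind⁻ (τS g) g G K (Si⊆Ind g g∈S K K∈Si)))

    K≤g : K ≤ g
    K≤g = proj₁ (proj₂ (proj₂ (Ind⁻ (τS g) g G K (Si⊆Ind g g∈S K K∈Si))))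

    K≢τ : K ≢ τS g
    K≢τ = proj₂ (proj₂ (proj₂ (Ind⁻ (τS g) g G K (Si⊆Ind g g∈S K K∈Si))))

    c≤K : c ≤ K
    c≤K = ≤-trans (x≤x∨y _ _) (≤-reflexive c∨τ≡K)

    c≤g : c ≤ g
    c≤g = ≤-trans c≤K K≤g

    c≰τ : ¬ c ≤ τS g
    c≰τ c≤τ = K≢τ (≤-antisym (≤-trans (≤-reflexive (sym c∨τ≡K)) (∨-least c≤τ ≤-refl)) τ≤K)

    ĉ : Factor K
    ĉ = c , T-∧⁺ (proj₁ c-comp) (T-∧⁺ (≤⇒≤ᵇ c≤K) (all⁻ _ {xs = elems} (tabulate (λ {F} _ → T-not⁺ (not-above F)))))
      where
        not-above : ∀ F → ¬ T (G F ∧ (F ≤ᵇ K) ∧ (c <ᵇ F))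
        not-above F F-above =
          let F∈G , rest   = T-∧⁻ (G F) F-above
              F≤K , c<ᵇF   = T-∧⁻ (F ≤ᵇ K) rest
              c≤F , c≢F    = <ᵇ⇒< c<ᵇF
              F∨τ≡K = ≤-antisym (∨-least (≤ᵇ⇒≤ F≤K) τ≤K)
                                (≤-trans (≤-reflexive (sym c∨τ≡K)) (∨-monotonic c≤F ≤-refl))
          in c≢F (≤-antisym c≤F (proj₂ (proj₂ c-comp) F F∈G F∨τ≡K))

    other-factors≤τ : ∀ (B : Factor K) → proj₁ B ≢ c → proj₁ B ≤ τS g
    other-factors≤τ B B≢c = other-factors-below K B ĉ (B≢c ∘ sym) ≤-refl τ≤K (≤-reflexive (sym c∨τ≡K))

    G-below-K⇒≤c : ∀ {F} → T (G F) → F ≤ K → ¬ F ≤ τS g → F ≤ c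
    G-below-K⇒≤c F∈G F≤K F≰τ with factor-above K _ F∈G F≤K
    ... | A , F≤A with proj₁ A ≟ c
    ...   | yes A≡c = ≤-trans F≤A (≤-reflexive A≡c)
    ...   | no  A≢c = ⊥-elim (F≰τ (≤-trans F≤A (other-factors≤τ A A≢c)))

  witness-comparable : ∀ {g F} → T (S g) → F ≤ g → (w : CompWitness F) → proj₁ w ≡ g ⊎ proj₁ w < g
  witness-comparable {g} g∈S F≤g (g′ , g′∈S , K′ , K′∈Si , F-comp) with g′ ≟ g
  ... | yes g′≡g = inj₁ g′≡g
  ... | no  g′≢g with g′ ≤? g
  ...   | yes g′≤g = inj₂ (g′≤g , g′≢g)
  ...   | no  g′≰g with g ≤? g′
  ...     | yes g≤g′ = ⊥-elim (Component.c≰τ g′∈S K′∈Si F-comp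
                                 (≤-trans F≤g (τ-upper ⊥ S g′ g∈S (g≤g′ , g′≢g ∘ sym))))
  ...     | no  g≰g′ = ⊥-elim (S-incomparable-disjoint g∈S g′∈S g≰g′ g′≰g (proj₁ F-comp) F≤g
                                   (Component.c≤g g′∈S K′∈Si F-comp))

  witness-unique : ∀ {F} (w w′ : CompWitness F)
                 → proj₁ w ≡ proj₁ w′ × proj₁ (proj₂ (proj₂ w)) ≡ proj₁ (proj₂ (proj₂ w′))
  witness-unique (g , g∈S , K , K∈Si , F-comp) (g′ , g′∈S , K′ , K′∈Si , F-comp′)
    with witness-comparable g∈S (Component.c≤g g∈S K∈Si F-comp) (g′ , g′∈S , K′ , K′∈Si , F-comp′)
  ... | inj₁ refl = refl , trans (sym (proj₁ (proj₂ F-comp))) (proj₁ (proj₂ F-comp′))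
  ... | inj₂ g′<g = ⊥-elim (Component.c≰τ g∈S K∈Si F-comp
                              (≤-trans (Component.c≤g g′∈S K′∈Si F-comp′) (τ-upper ⊥ S g g′∈S g′<g)))

  Comp-exists : ∀ g → T (S g) → ∀ K → T (Si g K) → Σ[ c ∈ Carrier ] IsComp (τS g) K c
  Comp-exists g g∈S K K∈Si = Ind⇒Comp (τS g) g K (Si⊆Ind g g∈S K K∈Si)

  -- The coordinate of Si g at K corresponds to the coordinate of S∘Si at c = Comp(K):
  -- z ↦ z ⊓ c maps [τSi, K] onto [τC, c], with inverse y ↦ y ⊔ τS g.
  module Restriction {g} (g∈S : T (S g)) {K} (K∈Si : T (Si g K)) {c} (c-comp : IsComp (τS g) K c) where
    open Component g∈S K∈Si c-comp public

    τC : Carrier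
    τC = τ L ⊥ S∘Si c

    τSi : Carrier
    τSi = τ L (τS g) (Si g) K

    τC≤c : τC ≤ c
    τC≤c = τ≤ ⊥ S∘Si c (⊥-minimum c)

    τS≤τSi : τS g ≤ τSi
    τS≤τSi = τ-lower (τS g) (Si g) K

    τSi≤K : τSi ≤ K
    τSi≤K = τ≤ (τS g) (Si g) K τ≤K

    lowered : Factor K → Carrier
    lowered B with proj₁ B ≟ c
    ... | yes _ = τC
    ... | no  _ = proj₁ B

    lowered-ĉ : lowered ĉ ≡ τC
    lowered-ĉ with c ≟ c
    ... | yes _   = refl
    ... | no  c≢c = ⊥-elim (c≢c refl)

    loweredFamily : Factors.Family K
    loweredFamily = Factors.family K lowered lowered≤
      where
        lowered≤ : ∀ B → lowered B ≤ proj₁ B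
        lowered≤ B with proj₁ B ≟ c
        ... | yes B≡c = ≤-trans τC≤c (≤-reflexive (sym B≡c))
        ... | no  _   = ≤-refl

    τS≤join-lowered : τS g ≤ Factors.join K loweredFamily
    τS≤join-lowered = τ-least ⊥ S g (⊥-minimum _) λ m m∈S m<g →
      let m≤τ = τ-upper ⊥ S g m∈S m<g
          A , m≤A = factor-above K m (S⊆G m m∈S) (≤-trans m≤τ τ≤K)
      in ≤-trans (m≤lowered m∈S m≤τ A m≤A) (Factors.≤join K loweredFamily A)
      where
        m≤lowered : ∀ {m} → T (S m) → m ≤ τS g → ∀ A → m ≤ proj₁ A → m ≤ lowered A
        m≤lowered {m} m∈S m≤τ A m≤A with proj₁ A ≟ c
        ... | no  _   = m≤A
        ... | yes A≡c = τ-upper ⊥ S∘Si c (S⊆S∘Si m m∈S)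
                          (≤-trans m≤A (≤-reflexive A≡c) , λ m≡c → c≰τ (≤-trans (≤-reflexive (sym m≡c)) m≤τ))

    τS∧c≤τC : τS g ⊓ c ≤ τC
    τS∧c≤τC =
      let w≤c = x∧y≤y (τS g) c
          w≤join = ≤-trans (Factors.join-single≤ K ĉ _ w≤c) (≤-trans (x∧y≤x _ _) τS≤join-lowered)
          w≤lowered = Factors.join-reflects K (Factors.singleFamily K ĉ _ w≤c) loweredFamily w≤join ĉ
      in ≤-trans (≤-reflexive (sym (Factors.single-at K ĉ _))) (≤-trans w≤lowered (≤-reflexive lowered-ĉ))

    z≤[z∧c]∨τS : ∀ {z} → z ≤ K → z ≤ (z ⊓ c) ⊔ τS g
    z≤[z∧c]∨τS = Factors.≤[z∧factor]∨t K ĉ other-factors≤τ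

    [y∨τS]∧c≤y : ∀ {y} → y ≤ c → τS g ⊓ c ≤ y → (y ⊔ τS g) ⊓ c ≤ y
    [y∨τS]∧c≤y = Factors.[y∨t]∧factor≤y K ĉ τ≤K

    τSi≤τC∨τS : τSi ≤ τC ⊔ τS g
    τSi≤τC∨τS = τ-least (τS g) (Si g) K (y≤x∨y _ _) λ K′ K′∈Si (K′≤K , K′≢K) →
      let c′ , c′-comp = Comp-exists g g∈S K′ K′∈Si
          c′∨τ≡K′      = proj₁ (proj₂ c′-comp)
          c′≤c = G-below-K⇒≤c (proj₁ c′-comp) (≤-trans (Component.c≤K g∈S K′∈Si c′-comp) K′≤K)
                              (Component.c≰τ g∈S K′∈Si c′-comp)
          c′≢c : c′ ≢ c
          c′≢c c′≡c = K′≢K (trans (sym c′∨τ≡K′) (trans (cong (_⊔ τS g) c′≡c) c∨τ≡K))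
          c′≤τC = τ-upper ⊥ S∘Si c (Comp∈S∘Si g g∈S K′ K′∈Si c′ c′-comp) (c′≤c , c′≢c)
      in ≤-trans (≤-reflexive (sym c′∨τ≡K′)) (∨-monotonic c′≤τC ≤-refl)

    τC≤τSi : τC ≤ τSi
    τC≤τSi = τ-least ⊥ S∘Si c (⊥-minimum _) λ C′ C′∈S∘Si C′<c →
      below (S∘Si-witness C′ C′∈S∘Si) C′<c
      where
        below : ∀ {C′} (w : CompWitness C′) → C′ < c → C′ ≤ τSi
        below w C′<c with witness-comparable g∈S (≤-trans (proj₁ C′<c) c≤g) w
        below (_ , g′∈S , K′ , K′∈Si , C′-comp) (C′≤c , C′≢c) | inj₁ refl =
          let K′≤K = ≤-trans (≤-reflexive (sym (proj₁ (proj₂ C′-comp))))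
                             (≤-trans (∨-monotonic C′≤c ≤-refl) (≤-reflexive c∨τ≡K))
              K′≢K = λ K′≡K → C′≢c (Comp-unique (subst (λ k → IsComp (τS g) k _) K′≡K C′-comp) c-comp)
          in ≤-trans (Component.c≤K g′∈S K′∈Si C′-comp) (τ-upper (τS g) (Si g) K K′∈Si (K′≤K , K′≢K))
        below (_ , g′∈S , K′ , K′∈Si , C′-comp) _ | inj₂ g′<g =
          ≤-trans (Component.c≤g g′∈S K′∈Si C′-comp) (≤-trans (τ-upper ⊥ S g g′∈S g′<g) τS≤τSi)

    τSi∧c≤τC : τSi ⊓ c ≤ τC
    τSi∧c≤τC = ≤-trans (∧-monotonic τSi≤τC∨τS ≤-refl) ([y∨τS]∧c≤y τC≤c τS∧c≤τC)

    τC≤∧c : ∀ {z} → τSi ≤ z → τC ≤ z ⊓ c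
    τC≤∧c τSi≤z = ∧-greatest (≤-trans τC≤τSi τSi≤z) τC≤c

    ∧c-reflects-≤ : ∀ {z z′} → z ≤ K → τSi ≤ z′ → z ⊓ c ≤ z′ ⊓ c → z ≤ z′
    ∧c-reflects-≤ z≤K τSi≤z′ z∧c≤z′∧c =
      ≤-trans (z≤[z∧c]∨τS z≤K) (∨-least (≤-trans z∧c≤z′∧c (x∧y≤x _ _)) (≤-trans τS≤τSi τSi≤z′))

    τSi≤∨τS : ∀ {y} → τC ≤ y → τSi ≤ y ⊔ τS g
    τSi≤∨τS τC≤y = ≤-trans τSi≤τC∨τS (∨-monotonic τC≤y ≤-refl)

    ∨τS≤K : ∀ {y} → y ≤ c → y ⊔ τS g ≤ K
    ∨τS≤K y≤c = ≤-trans (∨-monotonic y≤c ≤-refl) (≤-reflexive c∨τ≡K)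

    [y∨τS]∧c≡y : ∀ {y} → τC ≤ y → y ≤ c → (y ⊔ τS g) ⊓ c ≡ y
    [y∨τS]∧c≡y τC≤y y≤c =
      ≤-antisym ([y∨τS]∧c≤y y≤c (≤-trans τS∧c≤τC τC≤y)) (∧-greatest (x≤x∨y _ _) y≤c)

    ≤τSi⇒∧c≤τC : ∀ {z} → z ≤ τSi → z ⊓ c ≤ τC
    ≤τSi⇒∧c≤τC z≤τSi = ≤-trans (∧-monotonic z≤τSi ≤-refl) τSi∧c≤τC

    ∧c≤τC⇒≤τSi : ∀ {z} → z ≤ K → z ⊓ c ≤ τC → z ≤ τSi
    ∧c≤τC⇒≤τSi z≤K z∧c≤τC = ≤-trans (z≤[z∧c]∨τS z≤K) (∨-least (≤-trans z∧c≤τC τC≤τSi) τS≤τSi)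

    ∧c-preserves-Ind : ∀ {z} → τSi ≤ z → z ≤ K → T (Ind L τSi K (Ind L (τS g) g G) z)
                     → T (Ind L τC c G (z ⊓ c))
    ∧c-preserves-Ind {z} τSi≤z z≤K z∈Ind with Ind⁻ τSi K (Ind L (τS g) g G) z z∈Ind
    ... | (y , y∈Ind , τSi∨y≡z) , _ , _ , z≢τSi with Ind⁻ (τS g) g G y y∈Ind
    ...   | (F , F∈G , τS∨F≡y) , _ , _ , y≢τS =
      Ind⁺ τC c G (z ⊓ c) F F∈G τC∨F≡z∧c (τC≤∧c τSi≤z) (x∧y≤y _ _) z∧c≢τC
      where
        open ≤-Reasoning

        F≤z : F ≤ z
        F≤z = ≤-trans (y≤x∨y _ _) (≤-trans (≤-reflexive τS∨F≡y) (≤-trans (y≤x∨y _ _) (≤-reflexive τSi∨y≡z)))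

        F≤c : F ≤ c
        F≤c = G-below-K⇒≤c F∈G (≤-trans F≤z z≤K) λ F≤τS → y≢τS
          (≤-antisym (≤-trans (≤-reflexive (sym τS∨F≡y)) (∨-least ≤-refl F≤τS))
                     (≤-trans (x≤x∨y _ _) (≤-reflexive τS∨F≡y)))

        z≤[τC∨F]∨τS : z ≤ (τC ⊔ F) ⊔ τS g
        z≤[τC∨F]∨τS = begin
          z                          ≡⟨ sym τSi∨y≡z ⟩
          τSi ⊔ y                    ≤⟨ ∨-monotonic τSi≤τC∨τS (≤-reflexive (sym τS∨F≡y)) ⟩
          (τC ⊔ τS g) ⊔ (τS g ⊔ F)   ≤⟨ ∨-least (∨-monotonic (x≤x∨y _ _) ≤-refl)
                                               (∨-least (y≤x∨y _ _) (x≤y⇒x≤y∨z (y≤x∨y _ _))) ⟩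
          (τC ⊔ F) ⊔ τS g            ∎

        τC∨F≡z∧c : τC ⊔ F ≡ z ⊓ c
        τC∨F≡z∧c = ≤-antisym
          (∧-greatest (∨-least (≤-trans τC≤τSi τSi≤z) F≤z) (∨-least τC≤c F≤c))
          (≤-trans (∧-monotonic z≤[τC∨F]∨τS ≤-refl)
                   ([y∨τS]∧c≤y (∨-least τC≤c F≤c) (≤-trans τS∧c≤τC (x≤x∨y _ _))))

        z∧c≢τC : z ⊓ c ≢ τC
        z∧c≢τC z∧c≡τC = z≢τSi
          (≤-antisym (∧c≤τC⇒≤τSi z≤K (≤-reflexive z∧c≡τC)) τSi≤z)

    ∧c-reflects-Ind : ∀ {z} → τSi ≤ z → z ≤ K → T (Ind L τC c G (z ⊓ c))
                    → T (Ind L τSi K (Ind L (τS g) g G) z)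
    ∧c-reflects-Ind {z} τSi≤z z≤K z∧c∈Ind with Ind⁻ τC c G (z ⊓ c) z∧c∈Ind
    ... | (F , F∈G , τC∨F≡z∧c) , _ , _ , z∧c≢τC =
      Ind⁺ τSi K (Ind L (τS g) g G) z (τS g ⊔ F) y∈Ind τSi∨y≡z τSi≤z z≤K z≢τSi
      where
        open ≤-Reasoning

        F≤z∧c : F ≤ z ⊓ c
        F≤z∧c = ≤-trans (y≤x∨y _ _) (≤-reflexive τC∨F≡z∧c)

        y≢τS : τS g ⊔ F ≢ τS g
        y≢τS y≡τS = z∧c≢τC (≤-antisym
          (≤-trans (≤-reflexive (sym τC∨F≡z∧c))
                   (∨-least ≤-refl (≤-trans (∧-greatest (≤-trans (y≤x∨y _ _) (≤-reflexive y≡τS))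
                                                          (≤-trans F≤z∧c (x∧y≤y _ _)))
                                            τS∧c≤τC)))
          (τC≤∧c τSi≤z))

        y∈Ind : T (Ind L (τS g) g G (τS g ⊔ F))
        y∈Ind = Ind⁺ (τS g) g G _ F F∈G refl (x≤x∨y _ _)
                  (∨-least (≤-trans τ≤K K≤g) (≤-trans F≤z∧c (≤-trans (x∧y≤y _ _) c≤g))) y≢τS

        τSi∨y≡z : τSi ⊔ (τS g ⊔ F) ≡ z
        τSi∨y≡z = ≤-antisym
          (∨-least τSi≤z (∨-least (≤-trans τS≤τSi τSi≤z) (≤-trans F≤z∧c (x∧y≤x _ _))))
          (begin
            z                   ≤⟨ z≤[z∧c]∨τS z≤K ⟩
            (z ⊓ c) ⊔ τS g      ≡⟨ cong (_⊔ τS g) (sym τC∨F≡z∧c) ⟩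
            (τC ⊔ F) ⊔ τS g     ≤⟨ ∨-least (∨-monotonic τC≤τSi (y≤x∨y _ _)) (x≤z⇒x≤y∨z (x≤x∨y _ _)) ⟩
            τSi ⊔ (τS g ⊔ F)    ∎)

        z≢τSi : z ≢ τSi
        z≢τSi z≡τSi = z∧c≢τC (≤-antisym (≤τSi⇒∧c≤τC (≤-reflexive z≡τSi)) (τC≤∧c τSi≤z))

  Pair : Set
  Pair = Σ[ i ∈ Idx L S ] Idx L (Si (proj₁ i))

  outer : Pair → Carrier
  outer p = proj₁ (proj₁ p)

  inner : Pair → Carrier
  inner p = proj₁ (proj₂ p)

  Pair-≡ : ∀ (p q : Pair) → outer p ≡ outer q → inner p ≡ inner q → p ≡ q
  Pair-≡ ((g , a) , (K , b)) ((.g , a′) , (.K , b′)) refl refl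
    rewrite T-irrelevant a a′ | T-irrelevant b b′ = refl

  abstract
    pairOf : Idx L S∘Si → Pair
    pairOf (F , F∈S∘Si) =
      let g , g∈S , K , K∈Si , _ = S∘Si-witness F F∈S∘Si in (g , g∈S) , (K , K∈Si)

    pairOf-isComp : (C : Idx L S∘Si) → IsComp (τS (outer (pairOf C))) (inner (pairOf C)) (proj₁ C)
    pairOf-isComp (F , F∈S∘Si) = proj₂ (proj₂ (proj₂ (proj₂ (S∘Si-witness F F∈S∘Si))))

    compOf : Pair → Idx L S∘Si
    compOf ((g , g∈S) , (K , K∈Si)) =
      let c , c-comp = Comp-exists g g∈S K K∈Si in c , Comp∈S∘Si g g∈S K K∈Si c c-comp

    compOf-isComp : (p : Pair) → IsComp (τS (outer p)) (inner p) (proj₁ (compOf p))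
    compOf-isComp ((g , g∈S) , (K , K∈Si)) = proj₂ (Comp-exists g g∈S K K∈Si)

    compOf-pairOf : ∀ C → compOf (pairOf C) ≡ C
    compOf-pairOf C = Idx-≡ _ C (Comp-unique (compOf-isComp (pairOf C)) (pairOf-isComp C))

    pairOf-compOf : ∀ p → pairOf (compOf p) ≡ p
    pairOf-compOf p@((g , g∈S) , (K , K∈Si)) =
      let q = pairOf (compOf p)
          outer≡ , inner≡ = witness-unique
            (outer q , proj₂ (proj₁ q) , inner q , proj₂ (proj₂ q) , pairOf-isComp (compOf p))
            (g , g∈S , K , K∈Si , compOf-isComp p)
      in Pair-≡ q p outer≡ inner≡

  module AtComp (C : Idx L S∘Si) =
    Restriction (proj₂ (proj₁ (pairOf C))) (proj₂ (proj₂ (pairOf C))) (pairOf-isComp C)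
  module AtPair (p : Pair) = Restriction (proj₂ (proj₁ p)) (proj₂ (proj₂ p)) (compOf-isComp p)

  Nested : BuiltPoset
  Nested = ⊗ (Idx L S) (λ i → LS L (τS (proj₁ i)) (Ind L (τS (proj₁ i)) (proj₁ i) G) (Si (proj₁ i)))

  Composed : BuiltPoset
  Composed = LS L ⊥ G S∘Si

  module Nested = BuiltPoset Nested
  module Composed = BuiltPoset Composed

  coord : Nested.Carrier → Pair → Carrier
  coord x (i , k) = value (x i k)

  coord-lower : ∀ x p → AtPair.τSi p ≤ coord x p
  coord-lower x (i , k) = interval-lower (x i k)

  coord-upper : ∀ x p → coord x p ≤ inner p
  coord-upper x (i , k) = interval-upper (x i k)

  coord-bottom : (p : Pair) → Interval (AtPair.τSi p) (inner p)
  coord-bottom p = inInterval (AtPair.τSi p) ≤-refl (AtPair.τSi≤K p)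

  restrict : Nested.Carrier → Composed.Carrier
  restrict x C = inInterval (coord x (pairOf C) ⊓ proj₁ C)
                            (AtComp.τC≤∧c C (coord-lower x (pairOf C))) (x∧y≤y _ _)

  restrict-order : ∀ x y → Nested._≤_ x y ⇔ Composed._≤_ (restrict x) (restrict y)
  restrict-order x y = mk⇔ (λ x≤y C → ∧-monotonic (x≤y _ _) ≤-refl) reflect
    where
      reflect : Composed._≤_ (restrict x) (restrict y) → Nested._≤_ x y
      reflect rx≤ry i k = subst (λ p → coord x p ≤ coord y p) (pairOf-compOf (i , k))
        (AtComp.∧c-reflects-≤ (compOf (i , k)) (coord-upper x _) (coord-lower y _) (rx≤ry (compOf (i , k))))

  restrict-surjective : ∀ y → Σ[ x ∈ Nested.Carrier ] Composed._≤_ (restrict x) y × Composed._≤_ y (restrict x)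
  restrict-surjective y = x , (λ C → ≤-reflexive (restrict-x C)) , (λ C → ≤-reflexive (sym (restrict-x C)))
    where
      x : Nested.Carrier
      x i k = let yC = y (compOf (i , k)) in
        inInterval (value yC ⊔ τS (proj₁ i))
                   (AtPair.τSi≤∨τS (i , k) (interval-lower yC)) (AtPair.∨τS≤K (i , k) (interval-upper yC))

      restrict-x : ∀ C → value (restrict x C) ≡ value (y C)
      restrict-x C =
        trans (cong (λ C′ → (value (y C′) ⊔ τS (outer (pairOf C))) ⊓ proj₁ C) (compOf-pairOf C))
              (AtComp.[y∨τS]∧c≡y C (interval-lower (y C)) (interval-upper (y C)))

  IndAt : Pair → Carrier → Set
  IndAt p = T ∘ Ind L (AtPair.τSi p) (inner p) (Ind L (τS (outer p)) (outer p) G)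

  compOf-injective : ∀ p C → compOf p ≡ C → p ≡ pairOf C
  compOf-injective p C compOf-p≡C = trans (sym (pairOf-compOf p)) (cong pairOf compOf-p≡C)

  restrict-building : ∀ x → Nested.G x ⇔ Composed.G (restrict x)
  restrict-building x = mk⇔ forward backward
    where
      forward : Nested.G x → Composed.G (restrict x)
      forward (i , (k , x-ik∈Ind , k-only) , i-only) = compOf (i , k) , restrict-x∈Ind , others
        where
          x≤bottom : ∀ q → q ≢ (i , k) → coord x q ≤ AtPair.τSi q
          x≤bottom (i′ , k′) q≢ik with Idx-≟ i′ i
          ... | no i′≢i = i-only i′ i′≢i (coord-bottom ∘ (i′ ,_)) k′
          ... | yes refl with Idx-≟ k′ k
          ...   | yes refl = ⊥-elim (q≢ik refl)
          ...   | no  k′≢k = k-only k′ k′≢k (coord-bottom (i , k′))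

          restrict-x∈Ind : T (Ind L (AtComp.τC (compOf (i , k))) _ G (value (restrict x (compOf (i , k)))))
          restrict-x∈Ind = AtComp.∧c-preserves-Ind (compOf (i , k)) (coord-lower x _) (coord-upper x _)
            (subst (λ q → IndAt q (coord x q)) (sym (pairOf-compOf (i , k))) x-ik∈Ind)

          others : ∀ C → C ≢ compOf (i , k)
                 → IsBot (IntervalBP L (AtComp.τC C) (proj₁ C) (Ind L (AtComp.τC C) (proj₁ C) G)) (restrict x C)
          others C C≢ y′ = ≤-trans
            (AtComp.≤τSi⇒∧c≤τC C (x≤bottom (pairOf C) (λ e → C≢ (trans (sym (compOf-pairOf C)) (cong compOf e)))))
            (interval-lower y′)

      backward : Composed.G (restrict x) → Nested.G x
      backward (C , restrict-x∈Ind , C-only) = proj₁ q , (proj₂ q , x-q∈Ind , k-only) , i-only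
        where
          q = pairOf C

          x-q∈Ind : IndAt q (coord x q)
          x-q∈Ind = AtComp.∧c-reflects-Ind C (coord-lower x q) (coord-upper x q) restrict-x∈Ind

          x≤bottom : ∀ p → compOf p ≢ C → coord x p ≤ AtPair.τSi p
          x≤bottom p compOf-p≢C =
            let C′ = compOf p
                bottom = inInterval (AtComp.τC C′) ≤-refl (AtComp.τC≤c C′)
            in subst (λ p′ → coord x p′ ≤ AtPair.τSi p′) (pairOf-compOf p)
                 (AtComp.∧c≤τC⇒≤τSi C′ (coord-upper x _) (C-only C′ compOf-p≢C bottom))

          k-only : ∀ k′ → k′ ≢ proj₂ q → IsBot (IntervalBP L (AtPair.τSi (proj₁ q , k′)) (proj₁ k′)
                                                (Ind L (AtPair.τSi (proj₁ q , k′)) (proj₁ k′) (Ind L (τS (outer q)) (outer q) G)))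
                                              (x (proj₁ q) k′)
          k-only k′ k′≢k y′ = ≤-trans
            (x≤bottom (proj₁ q , k′) (λ e → k′≢k (Idx-≡ k′ _ (cong inner (compOf-injective _ C e)))))
            (interval-lower y′)

          i-only : ∀ j → j ≢ proj₁ q → IsBot (LS L (τS (proj₁ j)) (Ind L (τS (proj₁ j)) (proj₁ j) G) (Si (proj₁ j))) (x j)
          i-only j j≢i y′ k′ = ≤-trans
            (x≤bottom (j , k′) (λ e → j≢i (cong proj₁ (compOf-injective _ C e))))
            (interval-lower (y′ k′))

  composite-iso : BuiltIso Nested Composed
  composite-iso = record
    { to = restrict ; order-iff = restrict-order ; surjective = restrict-surjective ; building = restrict-building }

mainTheorem4 : (L : FinLattice) → IsGeometricLattice L
    → (G : Subset L) → IsBuildingSet L G → T (G (FinLattice.⊤ L))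
    → (S : Subset L) → IsIrredNested L (FinLattice.⊥ L) (FinLattice.⊤ L) G S
    → (Si : FinLattice.Carrier L → Subset L)
    → (∀ Gi → T (S Gi) →
         IsIrredNested L (τ L (FinLattice.⊥ L) S Gi) Gi
           (Ind L (τ L (FinLattice.⊥ L) S Gi) Gi G) (Si Gi))
    → BuiltIso
        (⊗ (Idx L S) (λ i →
           LS L (τ L (FinLattice.⊥ L) S (proj₁ i))
                (Ind L (τ L (FinLattice.⊥ L) S (proj₁ i)) (proj₁ i) G)
                (Si (proj₁ i))))
        (LS L (FinLattice.⊥ L) G (Composite L G S Si))
mainTheorem4 L geo G bs _ S S-nested Si Si-nested = Composition.composite-iso L geo G bs S S-nested Si Si-nested
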